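{- Let $\mathbf{v} = (v_n)_{n \geq 0}$ be the infinite word over the alphabet $\{0,1,2\}$ that is the fixed point, starting with $0$, of the morphism $0 \mapsto 012$, $1 \mapsto 02$, $2 \mapsto 1$ (so $\mathbf{v} = 012021012102012\cdots$). Then for each integer $k \geq 2$, the sequence $(v_{kn})_{n \geq 0}$ contains the square $00$ or the square $22$ as a factor, i.e., there exists $n \geq 0$ with $v_{kn} = v_{k(n+1)} = 0$ or $v_{kn} = v_{k(n+1)} = 2$.
   Context: A square is a nonempty word of the form $xx$. A factor of an infinite word is a finite block of consecutive letters. Indexing of $\mathbf{v}$ starts at $0$. -}

module Defs where

open import Data.Nat using (ℕ; zero; suc)
open import Data.Fin using (Fin; zero; suc)
open import Data.List using (List; []; _∷_; _++_; concatMap)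

Letter : Set
Letter = Fin 3

μ : Letter → List Letter
μ zero = zero ∷ suc zero ∷ suc (suc zero) ∷ []
μ (suc zero) = zero ∷ suc (suc zero) ∷ []
μ (suc (suc zero)) = suc zero ∷ []

μ* : List Letter → List Letter
μ* = concatMap μ

iter : ℕ → List Letter
iter zero = zero ∷ []
iter (suc m) = μ* (iter m)

-- index into a list, with a default value 0 when out of range
-- (never used out of range below: |μ^(i+1)(0)| > i)
at : List Letter → ℕ → Letter
at [] _ = zero
at (x ∷ xs) zero = x
at (x ∷ xs) (suc i) = at xs i

-- The fixed point v of μ starting with 0: since μ(0) starts with 0,
-- each μ^m(0) is a prefix of μ^(m+1)(0) and of v, and |μ^(i+1)(0)| ≥ i+1.
v : ℕ → Letter
v i = at (iter (suc i)) i

module Submission where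

-- Let t be the Thue–Morse sequence: t n is the parity of the number of
-- ones in the binary expansion of n.  The fixed point v is the ternary
-- "difference word" of t: v n is 0, 2 or 1 according as (t n, t (n+1)) is
-- (0,1), (1,0) or constant.  This follows from the fact that μ maps the
-- prefix of length n of that word onto its prefix of length 2n + t n.
-- Hence v (2j) is determined by t j alone, and v (2j+1) by t j, t (j+1).
--
-- The arithmetic input is the digit-splitting rule
--   t (H·2^M + x) = t H ⊕ t x   for x < 2^M,
-- together with the invertibility of odd numbers modulo powers of two.
-- For even k = 2k' the square sits at n = 0 or n = 1.  For odd k = 2d+3
-- we choose z with z + d = 2^L and t z = 1, and m with
-- k m = H·2^(L+1) + z.  Then k m + d + 1 = H·2^(L+1) + 2^L + 1, and the
-- splitting rule makes v (2km) and v (2km + k) both equal to 0 (if t H = 1)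
-- or both equal to 2 (if t H = 0): the square occurs at n = 2m.

open import Defs
open import Data.Nat using (ℕ; zero; suc; _+_; _*_; _^_; _≤_; _<_; z≤n; s≤s; ⌊_/2⌋)
open import Data.Nat.Properties
open import Data.Nat.Tactic.RingSolver using (solve-∀)
open import Data.Bool using (Bool; true; false; not; _xor_; if_then_else_)
open import Data.Bool.Properties using (not-involutive; not-distribʳ-xor; xor-identityʳ; xor-comm)
open import Data.Fin using (zero; suc)
open import Data.List using (List; []; _∷_; _++_; length)
open import Data.List.Properties using (++-assoc; ++-identityʳ; concatMap-++; length-++)
open import Data.Product using (∃; ∃₂; _×_; _,_)
open import Data.Sum using (_⊎_; inj₁; inj₂)
open import Relation.Nullary using (contradiction)
open import Relation.Binary.PropositionalEquality

open ≡-Reasoning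

-- Structural doubling; it reduces well under pattern matching, and
-- `double≡2*` hands identities over to the ring solver.
double : ℕ → ℕ
double zero    = zero
double (suc n) = suc (suc (double n))

double≡2* : ∀ n → double n ≡ 2 * n
double≡2* zero    = refl
double≡2* (suc n) = trans (cong (λ m → suc (suc m)) (double≡2* n)) (sym (*-suc 2 n))

data Parity : ℕ → Set where
  even : ∀ h → Parity (double h)
  odd  : ∀ h → Parity (suc (double h))

parityOf : ∀ n → Parity n
parityOf zero = even zero
parityOf (suc n) with parityOf n
... | even h = odd h
... | odd h  = even (suc h)

isOdd : ℕ → Bool
isOdd zero          = false
isOdd (suc zero)    = true
isOdd (suc (suc n)) = isOdd n

isOdd-double : ∀ n → isOdd (double n) ≡ false
isOdd-double zero    = refl
isOdd-double (suc n) = isOdd-double n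

isOdd-suc-double : ∀ n → isOdd (suc (double n)) ≡ true
isOdd-suc-double zero    = refl
isOdd-suc-double (suc n) = isOdd-suc-double n

half-double : ∀ n → ⌊ double n /2⌋ ≡ n
half-double zero    = refl
half-double (suc n) = cong suc (half-double n)

half-suc-double : ∀ n → ⌊ suc (double n) /2⌋ ≡ n
half-suc-double zero    = refl
half-suc-double (suc n) = cong suc (half-suc-double n)

-- t computed with a recursion budget f; each step strips the last binary
-- digit, so any budget f ≥ n gives the true value at n.
tmFuel : ℕ → ℕ → Bool
tmFuel zero    _ = false
tmFuel (suc f) n = isOdd n xor tmFuel f ⌊ n /2⌋

tmFuel-zero : ∀ f → tmFuel f 0 ≡ false
tmFuel-zero zero    = refl
tmFuel-zero (suc f) = tmFuel-zero f

half-≤ : ∀ {n f} → n ≤ suc f → ⌊ n /2⌋ ≤ f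
half-≤ {zero}  _         = z≤n
half-≤ {suc n} (s≤s n≤f) = ≤-trans (≤-pred (⌊n/2⌋<n n)) n≤f

tmFuel-stable : ∀ f g n → n ≤ f → n ≤ g → tmFuel f n ≡ tmFuel g n
tmFuel-stable zero    g       zero z≤n _   = sym (tmFuel-zero g)
tmFuel-stable (suc f) zero    zero _   z≤n = tmFuel-zero (suc f)
tmFuel-stable (suc f) (suc g) n    n≤f n≤g =
  cong (isOdd n xor_) (tmFuel-stable f g ⌊ n /2⌋ (half-≤ n≤f) (half-≤ n≤g))

tm : ℕ → Bool
tm n = tmFuel n n

tm-unfold : ∀ n → tm n ≡ isOdd n xor tm ⌊ n /2⌋
tm-unfold zero    = refl
tm-unfold (suc n) =
  cong (isOdd (suc n) xor_) (tmFuel-stable n _ _ (≤-pred (⌊n/2⌋<n n)) ≤-refl)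

tm-even : ∀ n → tm (double n) ≡ tm n
tm-even n = begin
  tm (double n)                                  ≡⟨ tm-unfold (double n) ⟩
  isOdd (double n) xor tm ⌊ double n /2⌋          ≡⟨ cong₂ _xor_ (isOdd-double n) (cong tm (half-double n)) ⟩
  tm n                                           ∎

tm-odd : ∀ n → tm (suc (double n)) ≡ not (tm n)
tm-odd n = begin
  tm (suc (double n))                               ≡⟨ tm-unfold (suc (double n)) ⟩
  isOdd (suc (double n)) xor tm ⌊ suc (double n) /2⌋ ≡⟨ cong₂ _xor_ (isOdd-suc-double n) (cong tm (half-suc-double n)) ⟩
  not (tm n)                                        ∎

-- Digit splitting: t (H·2^M + x) = t H ⊕ t x for x < 2^M

shift-even : ∀ H P h → H * (2 * P) + double h ≡ double (H * P + h)
shift-even H P h rewrite double≡2* h | double≡2* (H * P + h) = identity H P h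
  where
  identity : ∀ H P h → H * (2 * P) + 2 * h ≡ 2 * (H * P + h)
  identity = solve-∀

shift-odd : ∀ H P h → H * (2 * P) + suc (double h) ≡ suc (double (H * P + h))
shift-odd H P h = trans (+-suc (H * (2 * P)) (double h)) (cong suc (shift-even H P h))

half-< : ∀ h P → double h < 2 * P → h < P
half-< h P q = *-cancelˡ-< 2 h P (subst (_< 2 * P) (double≡2* h) q)

tm-split : ∀ M H x → x < 2 ^ M → tm (H * 2 ^ M + x) ≡ tm H xor tm x
tm-split zero H zero _ = begin
  tm (H * 1 + 0)   ≡⟨ cong tm (trans (+-identityʳ (H * 1)) (*-identityʳ H)) ⟩
  tm H             ≡⟨ xor-identityʳ (tm H) ⟨
  tm H xor false   ∎
tm-split zero H (suc x) (s≤s ())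
tm-split (suc M) H x x< with parityOf x
... | even h = begin
  tm (H * 2 ^ suc M + double h)  ≡⟨ cong tm (shift-even H (2 ^ M) h) ⟩
  tm (double (H * 2 ^ M + h))    ≡⟨ tm-even (H * 2 ^ M + h) ⟩
  tm (H * 2 ^ M + h)             ≡⟨ tm-split M H h (half-< h (2 ^ M) x<) ⟩
  tm H xor tm h                  ≡⟨ cong (tm H xor_) (tm-even h) ⟨
  tm H xor tm (double h)         ∎
... | odd h = begin
  tm (H * 2 ^ suc M + suc (double h))  ≡⟨ cong tm (shift-odd H (2 ^ M) h) ⟩
  tm (suc (double (H * 2 ^ M + h)))    ≡⟨ tm-odd (H * 2 ^ M + h) ⟩
  not (tm (H * 2 ^ M + h))             ≡⟨ cong not (tm-split M H h (half-< h (2 ^ M) (≤-trans (n≤1+n _) x<))) ⟩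
  not (tm H xor tm h)                  ≡⟨ not-distribʳ-xor (tm H) (tm h) ⟩
  tm H xor not (tm h)                  ≡⟨ cong (tm H xor_) (tm-odd h) ⟨
  tm H xor tm (suc (double h))         ∎

tm-top-bit : ∀ M x → x < 2 ^ M → tm (2 ^ M + x) ≡ not (tm x)
tm-top-bit M x x< = trans (cong (λ p → tm (p + x)) (sym (*-identityˡ (2 ^ M)))) (tm-split M 1 x x<)

-- Odd numbers are invertible modulo powers of two

regroup-even : ∀ H P r → double H * P + r ≡ H * (2 * P) + r
regroup-even H P r rewrite double≡2* H = identity H P r
  where
  identity : ∀ H P r → 2 * H * P + r ≡ H * (2 * P) + r
  identity = solve-∀

regroup-odd : ∀ c H P r → suc (double H) * P + r + suc (double c) * P ≡ (H + suc c) * (2 * P) + r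
regroup-odd c H P r rewrite double≡2* H | double≡2* c = identity c H P r
  where
  identity : ∀ c H P r → suc (2 * H) * P + r + suc (2 * c) * P ≡ (H + suc c) * (2 * P) + r
  identity = solve-∀

-- Every r is congruent modulo 2^M to a multiple of the odd number 2c+1.
-- If (2c+1) m = H·2^M + r with H odd, adding 2^M to m makes the quotient even.
odd-multiple : ∀ c M r → ∃₂ λ m H → suc (double c) * m ≡ H * 2 ^ M + r
odd-multiple c zero r = r , double c * r , base
  where
  base : suc (double c) * r ≡ double c * r * 1 + r
  base rewrite double≡2* c = identity c r
    where
    identity : ∀ c r → suc (2 * c) * r ≡ 2 * c * r * 1 + r
    identity = solve-∀
odd-multiple c (suc M) r with odd-multiple c M r
... | m , H , km≡ with parityOf H
...   | even H' = m , H' , trans km≡ (regroup-even H' (2 ^ M) r)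
...   | odd H'  = m + 2 ^ M , H' + suc c , (begin
  k * (m + 2 ^ M)                            ≡⟨ *-distribˡ-+ k m (2 ^ M) ⟩
  k * m + k * 2 ^ M                          ≡⟨ cong (_+ k * 2 ^ M) km≡ ⟩
  suc (double H') * 2 ^ M + r + k * 2 ^ M    ≡⟨ regroup-odd c H' (2 ^ M) r ⟩
  (H' + suc c) * 2 ^ suc M + r               ∎)
  where k = suc (double c)

pow-bound : ∀ d → 4 + d ≤ 2 ^ (2 + d)
pow-bound zero    = ≤-refl
pow-bound (suc d) =
  subst (_≤ 2 ^ (3 + d)) (+-comm (4 + d) 1)
        (+-mono-≤ (pow-bound d) (≤-trans (s≤s z≤n) (≤-trans (pow-bound d) (m≤m+n _ 0))))

-- Given 2^L ≥ 4 and 2^L ≥ d + 1: if t (2^L - (d+1)) = 0, then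
-- t (2^(L+1) - (d+1)) = t (2^L + (2^L - (d+1))) = 1.
complement-above : ∀ L d → 4 ≤ 2 ^ L → suc d ≤ 2 ^ L →
  ∃₂ λ L' z → 4 ≤ 2 ^ L' × z + suc d ≡ 2 ^ L' × tm z ≡ true
complement-above L d 4≤Q d<Q with m≤n⇒∃[o]m+o≡n d<Q
... | x , d+x≡Q with tm x in tx
...   | true  = L , x , 4≤Q , trans (+-comm x (suc d)) d+x≡Q , tx
...   | false = suc L , 2 ^ L + x , ≤-trans 4≤Q (m≤m+n _ _) , sum≡ , tz
  where
  x< : x < 2 ^ L
  x< = subst (x <_) d+x≡Q (s≤s (m≤n+m x d))
  sum≡ : 2 ^ L + x + suc d ≡ 2 ^ suc L
  sum≡ = begin
    2 ^ L + x + suc d     ≡⟨ +-assoc (2 ^ L) x (suc d) ⟩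
    2 ^ L + (x + suc d)   ≡⟨ cong (2 ^ L +_) (trans (+-comm x (suc d)) d+x≡Q) ⟩
    2 ^ L + 2 ^ L         ≡⟨ cong (2 ^ L +_) (+-identityʳ (2 ^ L)) ⟨
    2 ^ suc L             ∎
  tz : tm (2 ^ L + x) ≡ true
  tz = trans (tm-top-bit L x x<) (cong not tx)

complement-tm-one : ∀ d → ∃₂ λ L z → 4 ≤ 2 ^ L × z + d ≡ 2 ^ L × tm z ≡ true
complement-tm-one zero    = 2 , 4 , ≤-refl , refl , refl
complement-tm-one (suc d) = complement-above (3 + d) d
  (≤-trans (m≤m+n 4 (suc d)) (pow-bound (suc d)))
  (≤-trans (m≤n+m (suc d) 4) (pow-bound (suc d)))

-- v is the difference word of the Thue–Morse sequence

letter : Bool → Bool → Letter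
letter false true  = zero
letter true  false = suc (suc zero)
letter false false = suc zero
letter true  true  = suc zero

w : ℕ → Letter
w n = letter (tm n) (tm (suc n))

prefix : ℕ → List Letter
prefix zero    = []
prefix (suc n) = prefix n ++ w n ∷ []

-- The length 2n + t n of μ (w₀ … w_{n-1}).
imageLength : ℕ → ℕ
imageLength n = if tm n then suc (double n) else double n

w-even : ∀ n → w (double n) ≡ letter (tm n) (not (tm n))
w-even n = cong₂ letter (tm-even n) (tm-odd n)

w-odd : ∀ n → w (suc (double n)) ≡ letter (not (tm n)) (tm (suc n))
w-odd n = cong₂ letter (tm-odd n) (tm-even (suc n))

image-block : ∀ n → prefix (imageLength n) ++ μ (w n) ≡ prefix (imageLength (suc n))
image-block n with tm n | tm (suc n) | w-even n | w-odd n | w-even (suc n)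
... | false | false | w₀ | w₁ | _  rewrite w₀ | w₁ =
  sym (++-assoc (prefix (double n)) _ _)
... | false | true  | w₀ | w₁ | w₂ rewrite w₀ | w₁ | w₂ =
  trans (sym (++-assoc (prefix (double n)) _ _)) (sym (++-assoc (prefix (double n) ++ _) _ _))
... | true  | false | w₀ | w₁ | _  rewrite w₀ | w₁ = refl
... | true  | true  | w₀ | w₁ | w₂ rewrite w₀ | w₁ | w₂ =
  sym (++-assoc (prefix (double n) ++ _) _ _)

μ*-snoc : ∀ xs x → μ* (xs ++ x ∷ []) ≡ μ* xs ++ μ x
μ*-snoc xs x = trans (concatMap-++ μ xs (x ∷ [])) (cong (μ* xs ++_) (++-identityʳ (μ x)))

μ*-prefix : ∀ n → μ* (prefix n) ≡ prefix (imageLength n)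
μ*-prefix zero    = refl
μ*-prefix (suc n) = begin
  μ* (prefix n ++ w n ∷ [])              ≡⟨ μ*-snoc (prefix n) (w n) ⟩
  μ* (prefix n) ++ μ (w n)               ≡⟨ cong (_++ μ (w n)) (μ*-prefix n) ⟩
  prefix (imageLength n) ++ μ (w n)      ≡⟨ image-block n ⟩
  prefix (imageLength (suc n))           ∎

iterLength : ℕ → ℕ
iterLength zero    = 1
iterLength (suc m) = imageLength (iterLength m)

iter≡prefix : ∀ m → iter m ≡ prefix (iterLength m)
iter≡prefix zero    = refl
iter≡prefix (suc m) = trans (cong μ* (iter≡prefix m)) (μ*-prefix (iterLength m))

double-≥ : ∀ n → n ≤ double n
double-≥ zero    = z≤n
double-≥ (suc n) = s≤s (≤-trans (double-≥ n) (n≤1+n _))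

imageLength-≥ : ∀ n → double n ≤ imageLength n
imageLength-≥ n with tm n
... | false = ≤-refl
... | true  = n≤1+n _

imageLength-grows : ∀ n → suc (suc n) ≤ imageLength (suc n)
imageLength-grows n = ≤-trans (s≤s (s≤s (double-≥ n))) (imageLength-≥ (suc n))

iterLength-grows : ∀ m → suc m ≤ iterLength m
iterLength-grows zero = ≤-refl
iterLength-grows (suc m) with iterLength m | iterLength-grows m
... | suc l | s≤s m≤l = ≤-trans (s≤s (s≤s m≤l)) (imageLength-grows l)

length-prefix : ∀ n → length (prefix n) ≡ n
length-prefix zero    = refl
length-prefix (suc n) = trans (length-++ (prefix n)) (trans (+-comm (length (prefix n)) 1) (cong suc (length-prefix n)))

at-++ˡ : ∀ xs ys i → i < length xs → at (xs ++ ys) i ≡ at xs i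
at-++ˡ (x ∷ xs) ys zero    _         = refl
at-++ˡ (x ∷ xs) ys (suc i) (s≤s i<) = at-++ˡ xs ys i i<

at-++-length : ∀ xs y ys → at (xs ++ y ∷ ys) (length xs) ≡ y
at-++-length []       y ys = refl
at-++-length (x ∷ xs) y ys = at-++-length xs y ys

at-prefix : ∀ n i → i < n → at (prefix n) i ≡ w i
at-prefix (suc n) i i<1+n with m≤n⇒m<n∨m≡n (≤-pred i<1+n)
... | inj₁ i<n  = trans (at-++ˡ (prefix n) _ i (subst (i <_) (sym (length-prefix n)) i<n)) (at-prefix n i i<n)
... | inj₂ refl = subst (λ j → at (prefix (suc i)) j ≡ w i) (length-prefix i) (at-++-length (prefix i) (w i) [])

v≡w : ∀ i → v i ≡ w i
v≡w i = trans (cong (λ xs → at xs i) (iter≡prefix (suc i)))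
              (at-prefix (iterLength (suc i)) i (≤-trans (n≤1+n _) (iterLength-grows (suc i))))

-- Even positions of v only carry the letters 0 and 2.
v-even : ∀ j → v (double j) ≡ letter (tm j) (not (tm j))
v-even j = trans (v≡w (double j)) (w-even j)

v-odd : ∀ j → v (suc (double j)) ≡ letter (not (tm j)) (tm (suc j))
v-odd j = trans (v≡w (suc (double j))) (w-odd j)

-- Squares 00 and 22 in (v (k n))ₙ

SquareIn : ℕ → Set
SquareIn k = ∃ λ n → (v (k * n) ≡ zero × v (k * suc n) ≡ zero)
                   ⊎ (v (k * n) ≡ suc (suc zero) × v (k * suc n) ≡ suc (suc zero))

-- letter (not b) b is 0 or 2, so two consecutive such letters form a square.
square : ∀ k n b → v (k * n) ≡ letter (not b) b → v (k * suc n) ≡ letter (not b) b → SquareIn k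
square k n false p q = n , inj₂ (p , q)
square k n true  p q = n , inj₁ (p , q)

*-double : ∀ k m → k * double m ≡ double (k * m)
*-double k m rewrite double≡2* m | double≡2* (k * m) = identity k m
  where
  identity : ∀ k m → k * (2 * m) ≡ 2 * (k * m)
  identity = solve-∀

*-odd-odd : ∀ c m → suc (double c) * suc (double m) ≡ suc (double (suc (double c) * m + c))
*-odd-odd c m rewrite double≡2* c | double≡2* m | double≡2* (suc (2 * c) * m + c) = identity c m
  where
  identity : ∀ c m → suc (2 * c) * suc (2 * m) ≡ suc (2 * (suc (2 * c) * m + c))
  identity = solve-∀

v-double-at : ∀ j {b} → tm j ≡ b → v (double j) ≡ letter b (not b)
v-double-at j tj = trans (v-even j) (cong (λ b → letter b (not b)) tj)

-- k = 2k': v 0 = 0, and v (2k') = 0 when t k' = 0; otherwise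
-- v (2k') = v (4k') = 2 because t (2k') = t k' = 1.
even-square : ∀ k' → SquareIn (double k')
even-square k' with tm k' in tk
... | false = square (double k') 0 true
  (cong v (*-zeroʳ (double k')))
  (trans (cong v (*-identityʳ (double k'))) (v-double-at k' tk))
... | true  = square (double k') 1 false
  (trans (cong v (*-identityʳ (double k'))) (v-double-at k' tk))
  (trans (cong v (trans (*-double (double k') 1) (cong double (*-identityʳ (double k')))))
         (v-double-at (double k') (trans (tm-even k') tk)))

offset : ∀ {a B z d Q} e → a ≡ B + z → z + d ≡ Q → a + (e + d) ≡ B + (Q + e)
offset {B = B} {z} {d} e refl refl = identity B z d e
  where
  identity : ∀ B z d e → B + z + (e + d) ≡ B + (z + d + e)
  identity = solve-∀

+-<-double : ∀ Q {e} → e < Q → Q + e < 2 * Q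
+-<-double Q e<Q = +-monoʳ-< Q (subst (_ <_) (sym (+-identityʳ Q)) e<Q)

-- k = 2d+3: with z + d = 2^L, t z = 1 and k m = H·2^(L+1) + z, the
-- positions k·2m = 2km and k(2m+1) = 2(km + d + 1) + 1 both carry
-- the letter coding (not (t H), t H).
odd-square : ∀ d → SquareIn (suc (double (suc d)))
odd-square d with complement-tm-one d
... | L , z , 4≤Q , z+d≡Q , tz with odd-multiple (suc d) (suc L) z
... | m , H , km≡ = square k (double m) (tm H) v-left v-right
  where
  k = suc (double (suc d))
  Q = 2 ^ L
  j = k * m + suc d

  z< : z < 2 ^ suc L
  z< = ≤-<-trans (subst (z ≤_) z+d≡Q (m≤m+n z d))
                 (subst (_< 2 * Q) (+-identityʳ Q) (+-<-double Q (≤-trans (s≤s z≤n) 4≤Q)))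

  tm-km : tm (k * m) ≡ not (tm H)
  tm-km = begin
    tm (k * m)                ≡⟨ cong tm km≡ ⟩
    tm (H * 2 ^ suc L + z)    ≡⟨ tm-split (suc L) H z z< ⟩
    tm H xor tm z             ≡⟨ cong (tm H xor_) tz ⟩
    tm H xor true             ≡⟨ xor-comm (tm H) true ⟩
    not (tm H)                ∎

  -- Adding e + d to k m, for a small e with t e = 1, lands just above 2^L
  -- in the lower digits and so does not change the Thue–Morse value of H.
  tm-shifted : ∀ e → e < Q → tm e ≡ true → tm (k * m + (e + d)) ≡ tm H
  tm-shifted e e<Q te = begin
    tm (k * m + (e + d))          ≡⟨ cong tm (offset e km≡ z+d≡Q) ⟩
    tm (H * 2 ^ suc L + (Q + e))  ≡⟨ tm-split (suc L) H (Q + e) (+-<-double Q e<Q) ⟩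
    tm H xor tm (Q + e)           ≡⟨ cong (tm H xor_) (trans (tm-top-bit L e e<Q) (cong not te)) ⟩
    tm H xor false                ≡⟨ xor-identityʳ (tm H) ⟩
    tm H                          ∎

  v-left : v (k * double m) ≡ letter (not (tm H)) (tm H)
  v-left = begin
    v (k * double m)                             ≡⟨ cong v (*-double k m) ⟩
    v (double (k * m))                           ≡⟨ v-double-at (k * m) tm-km ⟩
    letter (not (tm H)) (not (not (tm H)))       ≡⟨ cong (letter _) (not-involutive (tm H)) ⟩
    letter (not (tm H)) (tm H)                   ∎

  v-right : v (k * suc (double m)) ≡ letter (not (tm H)) (tm H)
  v-right = begin
    v (k * suc (double m))              ≡⟨ cong v (*-odd-odd (suc d) m) ⟩
    v (suc (double j))                  ≡⟨ v-odd j ⟩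
    letter (not (tm j)) (tm (suc j))    ≡⟨ cong₂ letter (cong not (tm-shifted 1 (≤-trans (s≤s (s≤s z≤n)) 4≤Q) refl))
                                                        (trans (cong tm (sym (+-suc (k * m) (suc d))))
                                                               (tm-shifted 2 (≤-trans (s≤s (s≤s (s≤s z≤n))) 4≤Q) refl)) ⟩
    letter (not (tm H)) (tm H)          ∎

mainTheorem1 : (k : ℕ) → 2 ≤ k →
    ∃ λ n → (v (k * n) ≡ zero × v (k * suc n) ≡ zero)
          ⊎ (v (k * n) ≡ suc (suc zero) × v (k * suc n) ≡ suc (suc zero))
mainTheorem1 k 2≤k with parityOf k
... | even k'     = even-square k'
... | odd zero    = contradiction 2≤k λ { (s≤s ()) }
... | odd (suc d) = odd-square d
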